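{- Let $\lambda \ge 2$ be an integer. Let $T$ be a rooted tree in which every vertex has at most two children. Define the set of senators recursively from the root downward: a vertex $u$ is a senator if and only if $u$ has an ancestor $u'$ at distance exactly $\lambda$ and none of the ancestors of $u$ at distance $1,2,\dots,\lambda$ is a senator. Let $v$ be a senator, and let $S$ be the subtree of $T$ rooted at a child of $v$. If $S$ contains $i>0$ senators, then $S$ has at least $3i/2$ vertices.
   Context: Distance is the number of edges on the path from a vertex to its ancestor. -}

module Defs where

open import Data.Nat using (ℕ; zero; suc; _+_; _≤ᵇ_)
open import Data.Bool using (Bool; true; false; _∧_; not)
open import Data.List using (List; []; _∷_; length; take)
open import Data.Bool.ListAction using (any)
open import Data.Sum using (_⊎_)
open import Relation.Binary.PropositionalEquality using (_≡_)

-- Rooted trees in which every vertex has at most two children.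
-- `∅` is "no vertex"; every `node l r` is a vertex whose children are
-- the roots of l and r (those that are not ∅).
data BTree : Set where
  ∅    : BTree
  node : BTree → BTree → BTree

IsNode : BTree → Set
IsNode ∅          = Data.Empty.⊥ where import Data.Empty
IsNode (node _ _) = Data.Unit.⊤ where import Data.Unit

size : BTree → ℕ
size ∅          = 0
size (node l r) = suc (size l + size r)

data SubAt : BTree → ℕ → BTree → Set where
  here  : ∀ {t} → SubAt t 0 t
  left  : ∀ {l r d s} → SubAt l d s → SubAt (node l r) (suc d) s
  right : ∀ {l r d s} → SubAt r d s → SubAt (node l r) (suc d) s

-- The ancestors of a
-- vertex at depth n are exactly one vertex at each depth 0..n-1, and the
-- ancestor at distance k has depth n - k.  `history lam n` is the list of
-- senator statuses [ s_n , s_(n-1) , … , s_0 ] of a vertex at depth n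
-- (head) followed by its ancestors at distance 1, 2, …, n.
-- decide h: given the statuses h of the ancestors at distance 1,2,…,
-- the vertex is a senator iff it has an ancestor at distance exactly lam
-- (i.e. lam ≤ length h, as lam ≥ 1) and none of the ancestors at distance
-- 1..lam is a senator.
decide : ℕ → List Bool → Bool
decide lam h = (lam ≤ᵇ length h) ∧ not (any (λ b → b) (take lam h))

history : ℕ → ℕ → List Bool
history lam zero    = decide lam [] ∷ []
history lam (suc n) = let h = history lam n in decide lam h ∷ h

senatorAtDepth : ℕ → ℕ → Bool
senatorAtDepth lam n = decide lam (ancestors n)
  where
  ancestors : ℕ → List Bool
  ancestors zero    = []
  ancestors (suc m) = history lam m

IsSenator : ℕ → ℕ → Set
IsSenator lam n = senatorAtDepth lam n ≡ true

-- number of senators of T among the vertices of s, where the root of s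
-- has depth d in T
senatorsIn : ℕ → ℕ → BTree → ℕ
senatorsIn lam d ∅          = 0
senatorsIn lam d (node l r) =
  (if senatorAtDepth lam d then 1 else 0)
    + senatorsIn lam (suc d) l + senatorsIn lam (suc d) r
  where open Data.Bool using (if_then_else_)

module Submission where

-- Since
-- λ ≥ 1, the parent of every vertex is one of its ancestors at distance
-- 1..λ, so a child of a senator is never a senator: no two consecutive
-- depths carry senators.  That alone gives the bound.  For any marking
-- s : ℕ → Bool of depths with no two consecutive marked depths, a tree
-- whose root sits at an unmarked depth has  3·(marked vertices) ≤ 2·size,
-- and one whose root sits at a marked depth has  3·(marked) ≤ 1 + 2·size;
-- the two bounds are proved together by induction on the tree.
--
-- The theorem follows: S
-- hangs below the senator v, so its root is at an unmarked depth.

open import Defs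
open import Data.Nat using (ℕ; _≤_; _<_; _*_)
open import Data.Sum using (_⊎_)
open import Relation.Binary.PropositionalEquality using (_≡_)

open import Data.Nat using (zero; suc; _+_; z≤n; s≤s)
open import Data.Nat.Properties using (≤-trans; n≤1+n; +-mono-≤; +-monoʳ-≤; *-distribˡ-+; module ≤-Reasoning)
open import Data.Nat.Tactic.RingSolver using (solve-∀)
open import Data.Bool using (Bool; true; false; if_then_else_)
open import Data.Bool.Properties using (∧-zeroʳ)
open import Data.List using ([]; _∷_)
open import Relation.Binary.PropositionalEquality using (refl; cong₂; subst; sym)

NoTwoConsecutive : (ℕ → Bool) → Set
NoTwoConsecutive s = ∀ e → s e ≡ true → s (suc e) ≡ false

marked : (ℕ → Bool) → ℕ → BTree → ℕ
marked s d ∅          = 0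
marked s d (node l r) = (if s d then 1 else 0) + marked s (suc d) l + marked s (suc d) r

unmarked-step : ∀ a b x y → 3 * a ≤ 1 + 2 * x → 3 * b ≤ 1 + 2 * y
              → 3 * (a + b) ≤ 2 * suc (x + y)
unmarked-step a b x y p q = begin
  3 * (a + b)               ≡⟨ *-distribˡ-+ 3 a b ⟩
  3 * a + 3 * b             ≤⟨ +-mono-≤ p q ⟩
  (1 + 2 * x) + (1 + 2 * y) ≡⟨ rearrange x y ⟩
  2 * suc (x + y)           ∎
  where
  open ≤-Reasoning
  rearrange : ∀ x y → (1 + 2 * x) + (1 + 2 * y) ≡ 2 * suc (x + y)
  rearrange = solve-∀

marked-step : ∀ a b x y → 3 * a ≤ 2 * x → 3 * b ≤ 2 * y
            → 3 * (1 + a + b) ≤ 1 + 2 * suc (x + y)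
marked-step a b x y p q = begin
  3 * (1 + a + b)       ≡⟨ distribute a b ⟩
  3 + (3 * a + 3 * b)   ≤⟨ +-monoʳ-≤ 3 (+-mono-≤ p q) ⟩
  3 + (2 * x + 2 * y)   ≡⟨ rearrange x y ⟩
  1 + 2 * suc (x + y)   ∎
  where
  open ≤-Reasoning
  distribute : ∀ a b → 3 * (1 + a + b) ≡ 3 + (3 * a + 3 * b)
  distribute = solve-∀
  rearrange : ∀ x y → 3 + (2 * x + 2 * y) ≡ 1 + 2 * suc (x + y)
  rearrange = solve-∀

module Counting (s : ℕ → Bool) (alternating : NoTwoConsecutive s) where
  mutual
    unmarkedRoot : ∀ d → s d ≡ false → ∀ t → 3 * marked s d t ≤ 2 * size t
    unmarkedRoot d sd ∅          = z≤n
    unmarkedRoot d sd (node l r) rewrite sd =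
      unmarked-step (marked s (suc d) l) (marked s (suc d) r) (size l) (size r)
        (anyRoot (suc d) l) (anyRoot (suc d) r)

    markedRoot : ∀ d → s d ≡ true → ∀ t → 3 * marked s d t ≤ 1 + 2 * size t
    markedRoot d sd ∅          = z≤n
    markedRoot d sd (node l r) rewrite sd =
      marked-step (marked s (suc d) l) (marked s (suc d) r) (size l) (size r)
        (unmarkedRoot (suc d) (alternating d sd) l)
        (unmarkedRoot (suc d) (alternating d sd) r)

    anyRoot : ∀ d t → 3 * marked s d t ≤ 1 + 2 * size t
    anyRoot d t with s d in sd
    ... | true  = markedRoot d sd t
    ... | false = ≤-trans (unmarkedRoot d sd t) (n≤1+n _)

-- A vertex whose parent is a senator is not a senator: the parent is
-- the ancestor at distance 1, which is among the distances 1..λ.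
decide-after-senator : ∀ k h → decide (suc k) (true ∷ h) ≡ false
decide-after-senator k h = ∧-zeroʳ _

senators-alternate : ∀ lam → 1 ≤ lam → NoTwoConsecutive (senatorAtDepth lam)
senators-alternate (suc k) _ zero    sen =
  subst (λ b → decide (suc k) (b ∷ []) ≡ false) (sym sen) (decide-after-senator k [])
senators-alternate (suc k) _ (suc e) sen =
  subst (λ b → decide (suc k) (b ∷ history (suc k) e) ≡ false) (sym sen)
    (decide-after-senator k (history (suc k) e))

senatorsIn≡marked : ∀ lam d t → senatorsIn lam d t ≡ marked (senatorAtDepth lam) d t
senatorsIn≡marked lam d ∅          = refl
senatorsIn≡marked lam d (node l r) =
  cong₂ (λ a b → (if senatorAtDepth lam d then 1 else 0) + a + b)
    (senatorsIn≡marked lam (suc d) l) (senatorsIn≡marked lam (suc d) r)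

mainTheorem2 : (lam : ℕ) → 2 ≤ lam → (T : BTree) → (d : ℕ) → (l r : BTree)
    → SubAt T d (node l r) → IsSenator lam d
    → (S : BTree) → (S ≡ l ⊎ S ≡ r) → IsNode S
    → 0 < senatorsIn lam (Data.Nat.suc d) S
    → 3 * senatorsIn lam (Data.Nat.suc d) S ≤ 2 * size S
mainTheorem2 lam 2≤lam T d l r _ sen S _ _ _ =
  subst (λ n → 3 * n ≤ 2 * size S) (sym (senatorsIn≡marked lam (suc d) S))
    (unmarkedRoot (suc d) (alternating d sen) S)
  where
  alternating : NoTwoConsecutive (senatorAtDepth lam)
  alternating = senators-alternate lam (≤-trans (n≤1+n 1) 2≤lam)
  open Counting (senatorAtDepth lam) alternating
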